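{- Let $G$ be a bipartite graph with bipartition $\{X,Y\}$. For $S\subseteq X$ and $T\subseteq X\cup Y$ with $S\cap T=\varnothing$ let $\delta(S,T)=2|S|+\sum_{v\in T}\deg_{G-S}(v)-2|T\cap X|-q(S,T)$. Let $(S,T)$ be a minimum barrier of $G$. Then: (i) $T\subseteq X$; (ii) for each $T$-even component $C$ of $G-(S\cup T)$, $e_G(T,V(C))=0$; (iii) for each $T$-odd component $C$ of $G-(S\cup T)$ and each $u\in T$, $e_G(u,V(C))\leq 1$; (iv) if $O_1,\dots,O_q$ are the $T$-odd components of $G-(S\cup T)$, where $q=q(S,T)$, then $|T|-|S|>\frac12\sum_{i=1}^q\big(e_G(T,V(O_i))-1\big)$.
   Context: $G-S$ is the graph obtained by deleting $S$ and all incident edges. For disjoint vertex sets $A,B$, $e_G(A,B)$ is the number of edges with one end in $A$ and the other in $B$ ($e_G(u,B)=e_G(\{u\},B)$). A component $C$ of $G-(S\cup T)$ is $T$-odd if $e_G(T,V(C))$ is odd and $T$-even otherwise; $q(S,T)$ is the number of $T$-odd components. A pair $(S,T)$ with $S\subseteq X$, $T\subseteq X\cup Y$, $S\cap T=\varnothing$ is a barrier if $\delta(S,T)<0$; its size is $|S\cup T|$; a minimum barrier is a barrier of smallest size. -}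

module Defs where

open import Data.Bool using (Bool; true; false; if_then_else_)
open import Data.Nat using (ℕ; zero; suc; _+_; _*_; _%_)
open import Data.Integer as ℤ using (ℤ; +_; _-_; _<_)
open import Data.Fin using (Fin)
open import Data.Fin.Subset using (Subset; _∈_; _∉_; _⊆_; _∪_; _∩_; ∁; ∣_∣)
open import Data.Vec using (tabulate; lookup)
open import Data.List using (List; []; _∷_; length; map)
open import Data.List.Membership.Propositional using () renaming (_∈_ to _∈ₗ_)
open import Data.List.Relation.Unary.All using (All)
open import Data.List.Relation.Unary.Unique.Propositional using (Unique)
open import Data.Product using (_×_; ∃; Σ; _,_)
open import Function.Bundles using (_⇔_)
open import Relation.Binary.PropositionalEquality using (_≡_)
open import Relation.Nullary using (¬_)

record Graph (n : ℕ) : Set where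
  field
    adj     : Fin n → Fin n → Bool
    sym     : ∀ u v → adj u v ≡ adj v u
    irrefl  : ∀ u → adj u u ≡ false

open Graph public

module _ {n : ℕ} (G : Graph n) where

  Adj : Fin n → Fin n → Set
  Adj u v = adj G u v ≡ true

  IsBipartition : Subset n → Subset n → Set
  IsBipartition X Y =
    (Y ≡ ∁ X) × (∀ u v → Adj u v → u ∈ X → v ∈ Y) × (∀ u v → Adj u v → u ∈ Y → v ∈ X)

  N : Fin n → Subset n
  N v = tabulate (adj G v)

  sumOver : Subset n → (Fin n → ℕ) → ℕ
  sumOver A f = Data.Vec.sum (tabulate (λ v → if lookup A v then f v else 0))
    where import Data.Vec

  e₁ : Fin n → Subset n → ℕ
  e₁ u B = ∣ N u ∩ B ∣

  -- e_G(A , B) (for disjoint A, B): number of edges with one end in A, one in B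
  e : Subset n → Subset n → ℕ
  e A B = sumOver A (λ u → e₁ u B)

  degMinus : Subset n → Fin n → ℕ
  degMinus S v = ∣ N v ∩ ∁ S ∣

  data Reach (W : Subset n) (u : Fin n) : Fin n → Set where
    here : u ∈ W → Reach W u u
    step : ∀ {v w} → Reach W u v → Adj v w → w ∈ W → Reach W u w

  IsComponent : Subset n → Subset n → Set
  IsComponent W C =
    (∃ λ v → v ∈ C) × (∀ u v → u ∈ C → (v ∈ C ⇔ Reach W u v))

  Rest : Subset n → Subset n → Subset n
  Rest S T = ∁ (S ∪ T)

  Odd : ℕ → Set
  Odd m = m % 2 ≡ 1

  IsTOdd : Subset n → Subset n → Subset n → Set
  IsTOdd S T C = IsComponent (Rest S T) C × Odd (e T C)

  IsTEven : Subset n → Subset n → Subset n → Set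
  IsTEven S T C = IsComponent (Rest S T) C × ¬ Odd (e T C)

  -- Os lists the T-odd components of G - (S ∪ T), each exactly once
  -- (so q(S,T) = length Os)
  EnumTOdd : Subset n → Subset n → List (Subset n) → Set
  EnumTOdd S T Os = Unique Os × All (IsTOdd S T) Os × (∀ C → IsTOdd S T C → C ∈ₗ Os)

  Disjoint : Subset n → Subset n → Set
  Disjoint A B = ∀ v → v ∈ A → v ∉ B

  δ : Subset n → Subset n → Subset n → ℕ → ℤ
  δ X S T q = + (2 * ∣ S ∣ + sumOver T (degMinus S)) - + (2 * ∣ T ∩ X ∣ + q)

  IsBarrier : Subset n → Subset n → Subset n → Set
  IsBarrier X S T =
    S ⊆ X × Disjoint S T ×
    (∃ λ Os → EnumTOdd S T Os × δ X S T (length Os) < + 0)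

  IsMinBarrier : Subset n → Subset n → Subset n → Set
  IsMinBarrier X S T =
    IsBarrier X S T × (∀ S' T' → IsBarrier X S' T' → ∣ S ∪ T ∣ Data.Nat.≤ ∣ S' ∪ T' ∣)
    where import Data.Nat

module Submission where

-- Write R for the vertex set of G - (S ∪ T).  Counting edges leaving T,
-- Σ_{v∈T} deg_{G-S}(v) = e(T,T) + e(T,R), where e(T,T) is twice the number of edges inside T
-- and e(T,R) is the sum of e(T,C) over the components C of G[R], which is ≡ q(S,T) (mod 2).
-- So δ(S,T) is even, and a barrier has δ(S,T) ≤ -2.  Deleting a vertex v from T merges v with
-- the components adjacent to it, while the T-odd components not adjacent to v stay (T-v)-odd;
-- hence δ(S,T-v) ≤ δ(S,T) - deg_{G-S}(v) + 2[v∈X] + c_v, where c_v is the number of T-odd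
-- components adjacent to v.  By minimality (S,T-v) is not a barrier, so
-- c_v + 2[v∈X] ≥ deg_{G-S}(v) + 2.  Since c_v ≤ e(v,R) ≤ deg_{G-S}(v), this forces v ∈ X,
-- no edge from v to a T-even component, and at most one edge from v to each T-odd one.
-- Then T is independent, the degree sum is Σ_i e(T,O_i), and δ(S,T) < 0 rearranges to (iv).

open import Defs
open import Data.Nat using (ℕ; _≤_; _∸_; _*_)
open import Data.Integer as ℤ using (ℤ; +_; _-_)
open import Data.Fin using (Fin)
open import Data.Fin.Subset using (Subset; _∈_; _⊆_; ∣_∣)
open import Data.List using (List; map)
open import Data.Nat.ListAction using (sum)
open import Data.Product using (_×_)
open import Relation.Binary.PropositionalEquality using (_≡_)

import Algebra.Properties.CommutativeMonoid.Sum as CommutativeMonoidSum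
open import Data.Bool using (Bool; true; false; if_then_else_)
import Data.Bool as Bool
open import Data.Empty using (⊥-elim)
open import Data.Fin using (zero; suc)
open import Data.Fin.Properties using (¬∀⟶∃¬; any?) renaming (_≟_ to _≟ᶠ_)
open import Data.Fin.Subset using (_∉_; _∪_; _∩_; ∁; _─_; ⁅_⁆; ⋃; ⊥; inside; outside)
  renaming (_-_ to _∖_)
open import Data.Fin.Subset.Properties
  using (_∈?_; nonempty?; ⊆-antisym; ∉⊥; x∈⁅x⁆; x∈⁅y⁆⇒x≡y; ∣⁅x⁆∣≡1; p⊆q⇒∣p∣≤∣q∣; p⊂q⇒∣p∣<∣q∣;
         x∈∁p⇒x∉p; x∉p⇒x∈∁p; x∈p∪q⁺; x∈p∪q⁻; x∈p∩q⁺; x∈p∩q⁻; p∩q⊆p; ∩-comm;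
         p─q⊆p; x∈p∧x∉q⇒x∈p─q; p─⊥≡p; p─q─r≡p─q∪r; p∩q≢∅⇒∣p─q∣<∣p∣; x∈p∧x≢y⇒x∈p-y; x∈p⇒∣p-x∣<∣p∣)
import Data.Integer.Properties as ℤ
open import Data.List using ([]; _∷_; _++_; length; filter)
open import Data.List.Membership.Propositional using () renaming (_∈_ to _∈ₗ_)
open import Data.List.Membership.Propositional.Properties using (∈-filter⁺; ∈-filter⁻; ∈-++⁺ˡ; ∈-++⁺ʳ)
open import Data.List.Membership.Propositional.Properties.WithK using (unique∧set⇒bag)
open import Data.List.Properties using (map-cong; length-++-≤ˡ)
open import Data.List.Relation.Binary.BagAndSetEquality using (∼bag⇒↭)
open import Data.List.Relation.Binary.Permutation.Propositional.Properties using (↭-length)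
open import Data.List.Relation.Unary.All as All using (All; []; _∷_)
import Data.List.Relation.Unary.All.Properties as All
open import Data.List.Relation.Unary.AllPairs using (AllPairs; []; _∷_)
open import Data.List.Relation.Unary.Any using (here; there)
open import Data.List.Relation.Unary.Unique.Propositional using (Unique)
open import Data.List.Relation.Unary.Unique.Propositional.Properties using (++⁺; filter⁺)
open import Data.Nat using (zero; suc; _+_; _<_; _%_; z≤n; s≤s; parity)
open import Data.Nat.Induction using (<-wellFounded)
open import Data.Nat.Properties
open import Data.Nat.Solver using (module +-*-Solver)
open import Data.Parity.Base as ℙ using (0ℙ; 1ℙ)
import Data.Parity.Properties as ℙ
open import Data.Product using (∃; _,_; proj₁; proj₂)
open import Data.Sum using (_⊎_; inj₁; inj₂; [_,_]; map₂)
open import Data.Vec using ([]; _∷_; here; there; lookup; tabulate)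
import Data.Vec as Vec
import Data.Vec.Properties as Vec
open import Function using (_∘_; _⇔_; mk⇔; Equivalence; case_of_)
open import Induction.WellFounded using (Acc; acc)
open import Relation.Binary.PropositionalEquality as ≡
  using (_≢_; refl; trans; cong; cong₂; subst; subst₂; module ≡-Reasoning)
open import Relation.Nullary using (¬_; Dec; yes; no; does; _×-dec_)
open import Relation.Nullary.Decidable using (dec-true)

open CommutativeMonoidSum +-0-commutativeMonoid
  using (∑-distrib-+; ∑-comm; sum-cong-≗; sum-replicate-zero) renaming (sum to ∑)
open +-*-Solver using (solve; _:+_; _:*_; _:=_; con)

infix 9 _⇂_

_⇂_ : ∀ {m} → Subset m → (Fin m → ℕ) → Fin m → ℕ
(A ⇂ f) x = if lookup A x then f x else 0

𝟙[_] : ∀ {m} → Subset m → Fin m → ℕ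
𝟙[ A ] = A ⇂ λ _ → 1

⇂-∈ : ∀ {m} {A : Subset m} {x} (f : Fin m → ℕ) → x ∈ A → (A ⇂ f) x ≡ f x
⇂-∈ {A = A} {x} f x∈A rewrite Vec.[]=⇒lookup x∈A = refl

⇂-∉ : ∀ {m} {A : Subset m} {x} (f : Fin m → ℕ) → x ∉ A → (A ⇂ f) x ≡ 0
⇂-∉ {A = A} {x} f x∉A with lookup A x in eq
... | true = ⊥-elim (x∉A (Vec.lookup⇒[]= x A eq))
... | false = refl

sum-tabulate : ∀ {m} (g : Fin m → ℕ) → Vec.sum (tabulate g) ≡ ∑ g
sum-tabulate {zero} g = refl
sum-tabulate {suc m} g = cong (_+_ (g zero)) (sum-tabulate (g ∘ suc))

∑-zero : ∀ {m} {g : Fin m → ℕ} → (∀ x → g x ≡ 0) → ∑ g ≡ 0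
∑-zero {m} g≡0 = trans (sum-cong-≗ g≡0) (sum-replicate-zero m)

∑-nonzero : ∀ {m} (g : Fin m → ℕ) → ¬ ∑ g ≡ 0 → ∃ λ x → ¬ g x ≡ 0
∑-nonzero {m} g ∑g≢0 = ¬∀⟶∃¬ m _ (λ x → g x ≟ 0) (∑g≢0 ∘ ∑-zero)

∑-⁅⁆ : ∀ {m} (v : Fin m) (f : Fin m → ℕ) → ∑ (⁅ v ⁆ ⇂ f) ≡ f v
∑-⁅⁆ zero f = trans (cong (_+_ (f zero)) (∑-zero {g = ⊥ ⇂ (f ∘ suc)} (λ x → ⇂-∉ (f ∘ suc) ∉⊥))) (+-identityʳ (f zero))
∑-⁅⁆ (suc v) f = ∑-⁅⁆ v (f ∘ suc)

∣∣≡∑𝟙 : ∀ {m} (A : Subset m) → ∣ A ∣ ≡ ∑ 𝟙[ A ]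
∣∣≡∑𝟙 [] = refl
∣∣≡∑𝟙 (inside ∷ A) = cong suc (∣∣≡∑𝟙 A)
∣∣≡∑𝟙 (outside ∷ A) = ∣∣≡∑𝟙 A

∑-if : ∀ {m} c (h : Fin m → ℕ) → (if c then ∑ h else 0) ≡ ∑ λ i → if c then h i else 0
∑-if true h = refl
∑-if {m} false h = ≡.sym (∑-zero {m} {λ _ → 0} λ _ → refl)

-- Parity

parity≡1ℙ⇔odd : ∀ m → parity m ≡ 1ℙ ⇔ m % 2 ≡ 1
parity≡1ℙ⇔odd zero = mk⇔ (λ ()) (λ ())
parity≡1ℙ⇔odd (suc zero) = mk⇔ (λ _ → refl) (λ _ → refl)
parity≡1ℙ⇔odd (suc (suc m)) = parity≡1ℙ⇔odd m

¬odd⇒parity≡0ℙ : ∀ m → ¬ m % 2 ≡ 1 → parity m ≡ 0ℙ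
¬odd⇒parity≡0ℙ m ¬odd with parity m in eq
... | 0ℙ = refl
... | 1ℙ = ⊥-elim (¬odd (Equivalence.to (parity≡1ℙ⇔odd m) eq))

odd⇒1≤ : ∀ m → m % 2 ≡ 1 → 1 ≤ m
odd⇒1≤ (suc m) _ = s≤s z≤n

parity-2*+ : ∀ a m → parity (2 * a + m) ≡ parity m
parity-2*+ a m = begin
  parity (2 * a + m)              ≡⟨ ℙ.+-homo-+ (2 * a) m ⟩
  parity (2 * a) ℙ.+ parity m     ≡⟨ cong (ℙ._+ parity m) (ℙ.*-homo-* 2 a) ⟩
  parity m                        ∎
  where open ≡-Reasoning

parity-gap : ∀ {a b} → a < b → parity a ≡ parity b → 2 + a ≤ b
parity-gap {a} a<b pa≡pb with m≤n⇒m<n∨m≡n a<b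
... | inj₁ 1+a<b = 1+a<b
... | inj₂ refl = ⊥-elim (ℙ.p≢p⁻¹ (parity (suc a)) (≡.sym (trans (ℙ.suc-homo-⁻¹ a) pa≡pb)))

parity-sum-odd : ∀ {A : Set} (h : A → ℕ) {xs} → All (λ x → parity (h x) ≡ 1ℙ) xs →
  parity (sum (map h xs)) ≡ parity (length xs)
parity-sum-odd h [] = refl
parity-sum-odd h {x ∷ xs} (hx-odd ∷ rest-odd) = begin
  parity (h x + sum (map h xs))              ≡⟨ ℙ.+-homo-+ (h x) _ ⟩
  parity (h x) ℙ.+ parity (sum (map h xs))   ≡⟨ cong₂ ℙ._+_ hx-odd (parity-sum-odd h rest-odd) ⟩
  1ℙ ℙ.+ parity (length xs)                  ≡⟨ ℙ.+-homo-+ 1 (length xs) ⟨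
  parity (suc (length xs))                   ∎
  where open ≡-Reasoning

∑∑-parity-symmetric : ∀ {m} (M : Fin m → Fin m → ℕ) → (∀ i j → M i j ≡ M j i) → (∀ i → M i i ≡ 0) →
  parity (∑ λ i → ∑ (M i)) ≡ 0ℙ
∑∑-parity-symmetric {zero} M sym-M diag-M = refl
∑∑-parity-symmetric {suc m} M sym-M diag-M = begin
  parity ((M zero zero + a) + ∑ (λ i → M (suc i) zero + ∑ (M (suc i) ∘ suc)))
    ≡⟨ cong parity (cong₂ _+_ (cong (_+ a) (diag-M zero)) (∑-distrib-+ (λ i → M (suc i) zero) _)) ⟩
  parity (a + (∑ (λ i → M (suc i) zero) + rest))
    ≡⟨ cong (λ b → parity (a + (b + rest))) (sum-cong-≗ (λ i → sym-M (suc i) zero)) ⟩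
  parity (a + (a + rest))
    ≡⟨ cong parity (+-assoc a a rest) ⟨
  parity ((a + a) + rest)
    ≡⟨ ℙ.+-homo-+ (a + a) rest ⟩
  parity (a + a) ℙ.+ parity rest
    ≡⟨ cong₂ ℙ._+_ (trans (ℙ.+-homo-+ a a) (ℙ.p+p≡0ℙ (parity a)))
                   (∑∑-parity-symmetric (λ i j → M (suc i) (suc j)) (λ i j → sym-M (suc i) (suc j)) (diag-M ∘ suc)) ⟩
  0ℙ
    ∎
  where
  open ≡-Reasoning
  a = ∑ (M zero ∘ suc)
  rest = ∑ λ i → ∑ (M (suc i) ∘ suc)

x∈p─q⇒x∉q : ∀ {m} {p q : Subset m} {x} → x ∈ p ─ q → x ∉ q
x∈p─q⇒x∉q {p = _ ∷ p} {outside ∷ q} (there x∈p─q) (there x∈q) = x∈p─q⇒x∉q x∈p─q x∈q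
x∈p─q⇒x∉q {p = _ ∷ p} {inside ∷ q} (there x∈p─q) (there x∈q) = x∈p─q⇒x∉q x∈p─q x∈q

∈-tabulate⇔ : ∀ {m} {f : Fin m → Bool} {x} → x ∈ tabulate f ⇔ f x ≡ true
∈-tabulate⇔ {f = f} {x} = mk⇔
  (λ x∈ → trans (≡.sym (Vec.lookup∘tabulate f x)) (Vec.[]=⇒lookup x∈))
  (λ fx → Vec.lookup⇒[]= x _ (trans (Vec.lookup∘tabulate f x) fx))

∈⋃⁻ : ∀ {m} {x : Fin m} Cs → x ∈ ⋃ Cs → ∃ λ C → C ∈ₗ Cs × x ∈ C
∈⋃⁻ [] x∈⊥ = ⊥-elim (∉⊥ x∈⊥)
∈⋃⁻ (C ∷ Cs) x∈C∪⋃Cs with x∈p∪q⁻ C (⋃ Cs) x∈C∪⋃Cs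
... | inj₁ x∈C = C , here refl , x∈C
... | inj₂ x∈⋃Cs with ∈⋃⁻ Cs x∈⋃Cs
...   | D , D∈Cs , x∈D = D , there D∈Cs , x∈D

∈⋃⁺ : ∀ {m} {x : Fin m} {C Cs} → C ∈ₗ Cs → x ∈ C → x ∈ ⋃ Cs
∈⋃⁺ (here refl) x∈C = x∈p∪q⁺ (inj₁ x∈C)
∈⋃⁺ (there C∈Cs) x∈C = x∈p∪q⁺ (inj₂ (∈⋃⁺ C∈Cs x∈C))

+m-+n<0⇒m<n : ∀ {m n} → + m - + n ℤ.< + 0 → m < n
+m-+n<0⇒m<n {m} {n} m-n<0 with n ≤? m
... | no n≰m = ≰⇒> n≰m
... | yes n≤m with subst (ℤ._< + 0) (trans (ℤ.[+m]-[+n]≡m⊖n m n) (ℤ.⊖-≥ n≤m)) m-n<0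
...   | ℤ.+<+ ()

m<n⇒+m-+n<0 : ∀ {m n} → m < n → + m - + n ℤ.< + 0
m<n⇒+m-+n<0 {m} {n} m<n rewrite ℤ.[+m]-[+n]≡m⊖n m n | ℤ.⊖-< m<n with n ∸ m | m<n⇒0<n∸m m<n
... | suc _ | _ = ℤ.-<+

2s+m<2t⇒+m<2[t-s] : ∀ s t m → 2 * s + m < 2 * t → + m ℤ.< + 2 ℤ.* (+ t - + s)
2s+m<2t⇒+m<2[t-s] s t m 2s+m<2t = subst (+ m ℤ.<_) (≡.sym 2[t-s]≡2t∸2s)
  (ℤ.+<+ (m+n≤o⇒m≤o∸n (suc m) (subst (_≤ 2 * t) (cong suc (+-comm (2 * s) m)) 2s+m<2t)))
  where
  s≤t : s ≤ t
  s≤t = *-cancelˡ-≤ 2 (<⇒≤ (m+n≤o⇒m≤o (suc (2 * s)) 2s+m<2t))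
  2[t-s]≡2t∸2s : + 2 ℤ.* (+ t - + s) ≡ + (2 * t ∸ 2 * s)
  2[t-s]≡2t∸2s = begin
    + 2 ℤ.* (+ t - + s)   ≡⟨ cong (+ 2 ℤ.*_) (trans (ℤ.[+m]-[+n]≡m⊖n t s) (ℤ.⊖-≥ s≤t)) ⟩
    + 2 ℤ.* + (t ∸ s)     ≡⟨ ℤ.pos-* 2 (t ∸ s) ⟨
    + (2 * (t ∸ s))       ≡⟨ cong +_ (*-distribˡ-∸ 2 t s) ⟩
    + (2 * t ∸ 2 * s)     ∎
    where open ≡-Reasoning

deletion-arithmetic : ∀ s d Σ′ x t′ q k →
  2 + (2 * s + (d + Σ′)) ≤ 2 * (x + t′) + q → 2 * x + q ≤ k + d + 1 → 2 * s + Σ′ < 2 * t′ + k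
deletion-arithmetic s d Σ′ x t′ q k gap slack = +-cancelʳ-≤ (2 * x + q + d + 1) _ _ (begin
  suc (2 * s + Σ′) + (2 * x + q + d + 1)  ≡⟨ solve 4 (λ s d Σ′ x+q → (con 1 :+ (con 2 :* s :+ Σ′)) :+ (x+q :+ d :+ con 1)
                                                      := (con 2 :+ (con 2 :* s :+ (d :+ Σ′))) :+ x+q) refl s d Σ′ (2 * x + q) ⟩
  2 + (2 * s + (d + Σ′)) + (2 * x + q)    ≤⟨ +-mono-≤ gap slack ⟩
  2 * (x + t′) + q + (k + d + 1)          ≡⟨ solve 5 (λ x t′ q k d → (con 2 :* (x :+ t′) :+ q) :+ (k :+ d :+ con 1)
                                                      := (con 2 :* t′ :+ k) :+ (con 2 :* x :+ q :+ d :+ con 1)) refl x t′ q k d ⟩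
  2 * t′ + k + (2 * x + q + d + 1)        ∎)
  where open ≤-Reasoning

m≤n+o⇒1+m≤n+1+o : ∀ {m} n {o} → m ≤ n + o → suc m ≤ n + suc o
m≤n+o⇒1+m≤n+1+o {m} n {o} m≤n+o = subst (suc m ≤_) (≡.sym (+-suc n o)) (s≤s m≤n+o)

sum-map-∸1 : ∀ {A : Set} (h : A → ℕ) {xs} → All (λ x → 1 ≤ h x) xs →
  sum (map (λ x → h x ∸ 1) xs) + length xs ≡ sum (map h xs)
sum-map-∸1 h [] = refl
sum-map-∸1 h {x ∷ xs} (1≤hx ∷ rest) with h x | 1≤hx
... | suc k | _ = trans (+-suc (k + sum (map (λ x → h x ∸ 1) xs)) (length xs))
                    (cong suc (trans (+-assoc k _ _) (cong (_+_ k) (sum-map-∸1 h rest))))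

module _ {A : Set} (h : A → ℕ) where

  private
    zeros : List A → ℕ
    zeros xs = length (filter (λ x → h x ≟ 0) xs)

  length≤length-filter-zero+sum : ∀ xs → length xs ≤ length (filter (λ x → h x ≟ 0) xs) + sum (map h xs)
  length≤length-filter-zero+sum [] = z≤n
  length≤length-filter-zero+sum (x ∷ xs) with h x | length≤length-filter-zero+sum xs
  ... | zero | ih = s≤s ih
  ... | suc k | ih = m≤n+o⇒1+m≤n+1+o (zeros xs) (≤-trans ih (+-monoʳ-≤ (zeros xs) (m≤n+m _ k)))

  length<length-filter-zero+sum : ∀ {xs x} → x ∈ₗ xs → 2 ≤ h x →
    length xs < length (filter (λ x → h x ≟ 0) xs) + sum (map h xs)
  length<length-filter-zero+sum {x ∷ xs} (here refl) 2≤hx with h x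
  ... | suc (suc k) = m≤n+o⇒1+m≤n+1+o (zeros xs) (m≤n+o⇒1+m≤n+1+o (zeros xs)
                        (≤-trans (length≤length-filter-zero+sum xs) (+-monoʳ-≤ (zeros xs) (m≤n+m _ k))))
  length<length-filter-zero+sum {x ∷ xs} (here refl) (s≤s ()) | suc zero
  length<length-filter-zero+sum {y ∷ xs} (there x∈xs) 2≤hx with h y | length<length-filter-zero+sum x∈xs 2≤hx
  ... | zero | ih = s≤s ih
  ... | suc k | ih = m≤n+o⇒1+m≤n+1+o (zeros xs) (≤-trans ih (+-monoʳ-≤ (zeros xs) (m≤n+m _ k)))

module _ {n : ℕ} (G : Graph n) where

  sumOver≡∑ : ∀ A f → sumOver G A f ≡ ∑ (A ⇂ f)
  sumOver≡∑ A f = sum-tabulate (A ⇂ f)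

  sumOver-≗ : ∀ A B f g → (∀ x → (A ⇂ f) x ≡ (B ⇂ g) x) → sumOver G A f ≡ sumOver G B g
  sumOver-≗ A B f g pointwise = cong Vec.sum (Vec.tabulate-cong pointwise)

  sumOver-≗-+ : ∀ A B C f g h → (∀ x → (A ⇂ f) x ≡ (B ⇂ g) x + (C ⇂ h) x) →
    sumOver G A f ≡ sumOver G B g + sumOver G C h
  sumOver-≗-+ A B C f g h pointwise = begin
    sumOver G A f                  ≡⟨ sumOver≡∑ A f ⟩
    ∑ (A ⇂ f)                      ≡⟨ sum-cong-≗ pointwise ⟩
    ∑ (λ x → (B ⇂ g) x + (C ⇂ h) x) ≡⟨ ∑-distrib-+ (B ⇂ g) (C ⇂ h) ⟩
    ∑ (B ⇂ g) + ∑ (C ⇂ h)          ≡⟨ cong₂ _+_ (sumOver≡∑ B g) (sumOver≡∑ C h) ⟨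
    sumOver G B g + sumOver G C h  ∎
    where open ≡-Reasoning

  sumOver-cong : ∀ A {f g} → (∀ {x} → x ∈ A → f x ≡ g x) → sumOver G A f ≡ sumOver G A g
  sumOver-cong A {f} {g} f≡g = sumOver-≗ A A f g pointwise
    where
    pointwise : ∀ x → (A ⇂ f) x ≡ (A ⇂ g) x
    pointwise x with x ∈? A
    ... | yes x∈A rewrite ⇂-∈ f x∈A | ⇂-∈ g x∈A = f≡g x∈A
    ... | no x∉A rewrite ⇂-∉ f x∉A | ⇂-∉ g x∉A = refl

  sumOver-zero : ∀ A {f} → (∀ {x} → x ∈ A → f x ≡ 0) → sumOver G A f ≡ 0
  sumOver-zero A {f} f≡0 = trans (sumOver≡∑ A f) (∑-zero pointwise)
    where
    pointwise : ∀ x → (A ⇂ f) x ≡ 0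
    pointwise x with x ∈? A
    ... | yes x∈A = trans (⇂-∈ f x∈A) (f≡0 x∈A)
    ... | no x∉A = ⇂-∉ f x∉A

  sumOver-nonzero : ∀ A f → ¬ sumOver G A f ≡ 0 → ∃ λ x → x ∈ A × ¬ f x ≡ 0
  sumOver-nonzero A f ≢0 with ∑-nonzero (A ⇂ f) (≢0 ∘ trans (sumOver≡∑ A f))
  ... | x , fx≢0 with x ∈? A
  ...   | yes x∈A = x , x∈A , fx≢0 ∘ trans (⇂-∈ f x∈A)
  ...   | no x∉A = ⊥-elim (fx≢0 (⇂-∉ f x∉A))

  sumOver-+ : ∀ A f g → sumOver G A (λ x → f x + g x) ≡ sumOver G A f + sumOver G A g
  sumOver-+ A f g = sumOver-≗-+ A A A (λ x → f x + g x) f g pointwise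
    where
    pointwise : ∀ x → (A ⇂ λ x → f x + g x) x ≡ (A ⇂ f) x + (A ⇂ g) x
    pointwise x with lookup A x
    ... | true = refl
    ... | false = refl

  sumOver²≡∑∑ : ∀ A B (g : Fin n → Fin n → ℕ) →
    sumOver G A (λ a → sumOver G B (g a)) ≡ ∑ λ a → ∑ λ b → (A ⇂ λ a → (B ⇂ g a) b) a
  sumOver²≡∑∑ A B g = begin
    sumOver G A (λ a → sumOver G B (g a))  ≡⟨ sumOver≡∑ A _ ⟩
    ∑ (A ⇂ λ a → sumOver G B (g a))        ≡⟨ sum-cong-≗ (λ a → cong (λ s → if lookup A a then s else 0) (sumOver≡∑ B (g a))) ⟩
    ∑ (A ⇂ λ a → ∑ (B ⇂ g a))              ≡⟨ sum-cong-≗ (λ a → ∑-if (lookup A a) (B ⇂ g a)) ⟩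
    (∑ λ a → ∑ λ b → (A ⇂ λ a → (B ⇂ g a) b) a) ∎
    where open ≡-Reasoning

  sumOver-comm : ∀ A B (g : Fin n → Fin n → ℕ) →
    sumOver G A (λ a → sumOver G B (g a)) ≡ sumOver G B (λ b → sumOver G A (λ a → g a b))
  sumOver-comm A B g = begin
    sumOver G A (λ a → sumOver G B (g a))                ≡⟨ sumOver²≡∑∑ A B g ⟩
    (∑ λ a → ∑ λ b → (A ⇂ λ a → (B ⇂ g a) b) a)          ≡⟨ ∑-comm {n} {n} (λ a b → (A ⇂ λ a → (B ⇂ g a) b) a) ⟩
    (∑ λ b → ∑ λ a → (A ⇂ λ a → (B ⇂ g a) b) a)          ≡⟨ sum-cong-≗ (λ b → sum-cong-≗ (λ a → ⇂-swap a b)) ⟩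
    (∑ λ b → ∑ λ a → (B ⇂ λ b → (A ⇂ λ a → g a b) a) b)  ≡⟨ sumOver²≡∑∑ B A (λ b a → g a b) ⟨
    sumOver G B (λ b → sumOver G A (λ a → g a b))        ∎
    where
    open ≡-Reasoning
    ⇂-swap : ∀ a b → (A ⇂ λ a → (B ⇂ g a) b) a ≡ (B ⇂ λ b → (A ⇂ λ a → g a b) a) b
    ⇂-swap a b with lookup A a | lookup B b
    ... | true | true = refl
    ... | true | false = refl
    ... | false | true = refl
    ... | false | false = refl

  sumOver-⊎ : ∀ {A B C} f → (∀ {x} → x ∈ A → x ∈ B ⊎ x ∈ C) → B ⊆ A → C ⊆ A → Disjoint G B C →
    sumOver G A f ≡ sumOver G B f + sumOver G C f
  sumOver-⊎ {A} {B} {C} f A⊆B∪C B⊆A C⊆A B∩C≡∅ = sumOver-≗-+ A B C f f f pointwise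
    where
    pointwise : ∀ x → (A ⇂ f) x ≡ (B ⇂ f) x + (C ⇂ f) x
    pointwise x with x ∈? B | x ∈? C
    ... | yes x∈B | _ rewrite ⇂-∈ f (B⊆A x∈B) | ⇂-∈ f x∈B | ⇂-∉ f (B∩C≡∅ x x∈B) = ≡.sym (+-identityʳ (f x))
    ... | no x∉B | yes x∈C rewrite ⇂-∈ f (C⊆A x∈C) | ⇂-∉ f x∉B | ⇂-∈ f x∈C = refl
    ... | no x∉B | no x∉C rewrite ⇂-∉ f x∉B | ⇂-∉ f x∉C = ⇂-∉ f ([ x∉B , x∉C ] ∘ A⊆B∪C)

  sumOver-─ : ∀ {A B} f → B ⊆ A → sumOver G A f ≡ sumOver G B f + sumOver G (A ─ B) f
  sumOver-─ {A} {B} f B⊆A = sumOver-⊎ f split B⊆A (p─q⊆p A B) (λ x x∈B x∈A─B → x∈p─q⇒x∉q x∈A─B x∈B)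
    where
    split : ∀ {x} → x ∈ A → x ∈ B ⊎ x ∈ A ─ B
    split {x} x∈A with x ∈? B
    ... | yes x∈B = inj₁ x∈B
    ... | no x∉B = inj₂ (x∈p∧x∉q⇒x∈p─q x∈A x∉B)

  sumOver-remove : ∀ {A v} f → v ∈ A → sumOver G A f ≡ f v + sumOver G (A ∖ v) f
  sumOver-remove {A} {v} f v∈A = begin
    sumOver G A f                            ≡⟨ sumOver-─ f ⁅v⁆⊆A ⟩
    sumOver G ⁅ v ⁆ f + sumOver G (A ∖ v) f  ≡⟨ cong (_+ sumOver G (A ∖ v) f) (trans (sumOver≡∑ ⁅ v ⁆ f) (∑-⁅⁆ v f)) ⟩
    f v + sumOver G (A ∖ v) f                ∎
    where
    open ≡-Reasoning
    ⁅v⁆⊆A : ⁅ v ⁆ ⊆ A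
    ⁅v⁆⊆A x∈⁅v⁆ = subst (_∈ A) (≡.sym (x∈⁅y⁆⇒x≡y v x∈⁅v⁆)) v∈A

  ∣∩∣≡sumOver𝟙 : ∀ P B → ∣ P ∩ B ∣ ≡ sumOver G B 𝟙[ P ]
  ∣∩∣≡sumOver𝟙 P B = trans (∣∣≡∑𝟙 (P ∩ B)) (trans (sum-cong-≗ pointwise) (≡.sym (sumOver≡∑ B 𝟙[ P ])))
    where
    pointwise : ∀ x → 𝟙[ P ∩ B ] x ≡ (B ⇂ 𝟙[ P ]) x
    pointwise x with x ∈? B | x ∈? P
    ... | yes x∈B | yes x∈P rewrite ⇂-∈ 𝟙[ P ] x∈B | ⇂-∈ (λ _ → 1) x∈P = ⇂-∈ (λ _ → 1) (x∈p∩q⁺ (x∈P , x∈B))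
    ... | yes x∈B | no x∉P rewrite ⇂-∈ 𝟙[ P ] x∈B | ⇂-∉ (λ _ → 1) x∉P = ⇂-∉ (λ _ → 1) (x∉P ∘ proj₁ ∘ x∈p∩q⁻ P B)
    ... | no x∉B | _ rewrite ⇂-∉ 𝟙[ P ] x∉B = ⇂-∉ (λ _ → 1) (x∉B ∘ proj₂ ∘ x∈p∩q⁻ P B)

  sumOver-─⋃ : ∀ {W Cs} f → All (_⊆ W) Cs → AllPairs (Disjoint G) Cs →
    sumOver G W f ≡ sum (map (λ C → sumOver G C f) Cs) + sumOver G (W ─ ⋃ Cs) f
  sumOver-─⋃ {W} {[]} f [] [] = cong (λ V → sumOver G V f) (≡.sym (p─⊥≡p W))
  sumOver-─⋃ {W} {C ∷ Cs} f (C⊆W ∷ Cs⊆W) (C∩Cs≡∅ ∷ Cs-disjoint) = begin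
    sumOver G W f
      ≡⟨ sumOver-─ f C⊆W ⟩
    sumOver G C f + sumOver G (W ─ C) f
      ≡⟨ cong (_+_ (sumOver G C f)) (sumOver-─⋃ f (All.zipWith within (Cs⊆W , C∩Cs≡∅)) Cs-disjoint) ⟩
    sumOver G C f + (sum (map (λ D → sumOver G D f) Cs) + sumOver G (W ─ C ─ ⋃ Cs) f)
      ≡⟨ +-assoc (sumOver G C f) _ _ ⟨
    sumOver G C f + sum (map (λ D → sumOver G D f) Cs) + sumOver G (W ─ C ─ ⋃ Cs) f
      ≡⟨ cong (λ V → _ + sumOver G V f) (p─q─r≡p─q∪r W C (⋃ Cs)) ⟩
    sum (map (λ D → sumOver G D f) (C ∷ Cs)) + sumOver G (W ─ ⋃ (C ∷ Cs)) f
      ∎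
    where
    open ≡-Reasoning
    within : ∀ {D} → D ⊆ W × Disjoint G C D → D ⊆ W ─ C
    within (D⊆W , C∩D≡∅) {x} x∈D = x∈p∧x∉q⇒x∈p─q (D⊆W x∈D) (λ x∈C → C∩D≡∅ x x∈C x∈D)

  -- Reachability and components

  adj-sym : ∀ {u v} → Adj G u v → Adj G v u
  adj-sym {u} {v} u~v = trans (≡.sym (Graph.sym G u v)) u~v

  adj? : ∀ u v → Dec (Adj G u v)
  adj? u v = adj G u v Bool.≟ true

  Reach-source : ∀ {W u v} → Reach G W u v → u ∈ W
  Reach-source (here u∈W) = u∈W
  Reach-source (step r _ _) = Reach-source r

  Reach-target : ∀ {W u v} → Reach G W u v → v ∈ W
  Reach-target (here v∈W) = v∈W
  Reach-target (step _ _ v∈W) = v∈W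

  Reach-trans : ∀ {W u v w} → Reach G W u v → Reach G W v w → Reach G W u w
  Reach-trans r (here _) = r
  Reach-trans r (step r′ x~w w∈W) = step (Reach-trans r r′) x~w w∈W

  Reach-sym : ∀ {W u v} → Reach G W u v → Reach G W v u
  Reach-sym (here u∈W) = here u∈W
  Reach-sym (step r x~v v∈W) = Reach-trans (step (here v∈W) (adj-sym x~v) (Reach-target r)) (Reach-sym r)

  Reach-mono : ∀ {W W′} → W ⊆ W′ → ∀ {u v} → Reach G W u v → Reach G W′ u v
  Reach-mono W⊆W′ (here u∈W) = here (W⊆W′ u∈W)
  Reach-mono W⊆W′ (step r x~v v∈W) = step (Reach-mono W⊆W′ r) x~v (W⊆W′ v∈W)

  Reach-cons : ∀ {W u w v} → u ∈ W → Adj G u w → Reach G W w v → Reach G W u v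
  Reach-cons u∈W u~w w↝v = Reach-trans (step (here u∈W) u~w (Reach-source w↝v)) w↝v

  Reach-uncons : ∀ {W u v} → Reach G W u v → u ≡ v ⊎ ∃ λ w → Adj G u w × Reach G (W ∖ u) w v
  Reach-uncons (here _) = inj₁ refl
  Reach-uncons {W} {u} (step {w = w} r x~w w∈W) with w ≟ᶠ u | Reach-uncons r
  ... | yes w≡u | _ = inj₁ (≡.sym w≡u)
  ... | no w≢u | inj₁ refl = inj₂ (w , x~w , here (x∈p∧x≢y⇒x∈p-y w∈W w≢u))
  ... | no w≢u | inj₂ (w′ , u~w′ , w′↝x) = inj₂ (w′ , u~w′ , step w′↝x x~w (x∈p∧x≢y⇒x∈p-y w∈W w≢u))

  reach? : ∀ W u v → Dec (Reach G W u v)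
  reach? W = go W (<-wellFounded ∣ W ∣)
    where
    go : ∀ W → Acc _<_ ∣ W ∣ → ∀ u v → Dec (Reach G W u v)
    go W (acc smaller) u v with u ∈? W | u ≟ᶠ v
    ... | no u∉W | _ = no (u∉W ∘ Reach-source)
    ... | yes u∈W | yes refl = yes (here u∈W)
    ... | yes u∈W | no u≢v
      with any? (λ w → adj? u w ×-dec go (W ∖ u) (smaller (x∈p⇒∣p-x∣<∣p∣ u∈W)) w v)
    ...   | yes (w , u~w , w↝v) = yes (Reach-cons u∈W u~w (Reach-mono (p─q⊆p W ⁅ u ⁆) w↝v))
    ...   | no ∄w = no ([ u≢v , ∄w ] ∘ Reach-uncons)

  component : Subset n → Fin n → Subset n
  component W u = tabulate (does ∘ reach? W u)

  ∈component⇔Reach : ∀ {W u v} → v ∈ component W u ⇔ Reach G W u v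
  ∈component⇔Reach {W} {u} {v} = mk⇔
    (reached (reach? W u v) ∘ Equivalence.to ∈-tabulate⇔)
    (Equivalence.from ∈-tabulate⇔ ∘ dec-true (reach? W u v))
    where
    reached : (d : Dec (Reach G W u v)) → does d ≡ true → Reach G W u v
    reached (yes u↝v) _ = u↝v
    reached (no _) ()

  component-isComponent : ∀ {W u} → u ∈ W → IsComponent G W (component W u)
  component-isComponent {W} {u} u∈W = (u , from (here u∈W)) , λ x y x∈C →
    mk⇔ (λ y∈C → Reach-trans (Reach-sym (to x∈C)) (to y∈C)) (λ x↝y → from (Reach-trans (to x∈C) x↝y))
    where
    to : ∀ {v} → v ∈ component W u → Reach G W u v
    to = Equivalence.to ∈component⇔Reach
    from : ∀ {v} → Reach G W u v → v ∈ component W u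
    from = Equivalence.from ∈component⇔Reach

  module _ {W C : Subset n} (C-comp : IsComponent G W C) where

    isComponent-closed : ∀ {x y} → x ∈ C → Reach G W x y → y ∈ C
    isComponent-closed x∈C = Equivalence.from (proj₂ C-comp _ _ x∈C)

    isComponent-connected : ∀ {x y} → x ∈ C → y ∈ C → Reach G W x y
    isComponent-connected x∈C = Equivalence.to (proj₂ C-comp _ _ x∈C)

    isComponent-⊆ : C ⊆ W
    isComponent-⊆ x∈C = Reach-source (isComponent-connected x∈C x∈C)

    isComponent-adj : ∀ {x y} → x ∈ C → y ∈ W → Adj G x y → y ∈ C
    isComponent-adj x∈C y∈W x~y = isComponent-closed x∈C (step (here (isComponent-⊆ x∈C)) x~y y∈W)

  isComponent-unique : ∀ {W C D x} → IsComponent G W C → IsComponent G W D → x ∈ C → x ∈ D → C ≡ D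
  isComponent-unique C-comp D-comp x∈C x∈D = ⊆-antisym
    (λ y∈C → isComponent-closed D-comp x∈D (isComponent-connected C-comp x∈C y∈C))
    (λ y∈D → isComponent-closed C-comp x∈C (isComponent-connected D-comp x∈D y∈D))

  isComponent-disjoint : ∀ {W C D} → IsComponent G W C → IsComponent G W D → C ≢ D → Disjoint G C D
  isComponent-disjoint C-comp D-comp C≢D x x∈C x∈D = C≢D (isComponent-unique C-comp D-comp x∈C x∈D)

  components-disjoint : ∀ {W Cs} → All (IsComponent G W) Cs → Unique Cs → AllPairs (Disjoint G) Cs
  components-disjoint [] [] = []
  components-disjoint (C-comp ∷ comps) (C∉Cs ∷ unique) =
    All.zipWith (λ (D-comp , C≢D) → isComponent-disjoint C-comp D-comp C≢D) (comps , C∉Cs)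
    ∷ components-disjoint comps unique

  isComponent-grow : ∀ {W W′ C} → IsComponent G W C → W ⊆ W′ →
    (∀ {x y} → x ∈ C → y ∈ W′ → Adj G x y → y ∈ W) → IsComponent G W′ C
  isComponent-grow {W} {W′} {C} C-comp W⊆W′ no-exit = proj₁ C-comp , λ x y x∈C →
    mk⇔ (Reach-mono W⊆W′ ∘ isComponent-connected C-comp x∈C)
        (isComponent-closed C-comp x∈C ∘ stay x∈C)
    where
    stay : ∀ {x y} → x ∈ C → Reach G W′ x y → Reach G W x y
    stay x∈C (here _) = here (isComponent-⊆ C-comp x∈C)
    stay x∈C (step r z~y y∈W′) = step (stay x∈C r) z~y (no-exit (isComponent-closed C-comp x∈C (stay x∈C r)) y∈W′ z~y)

  isComponent-shrink : ∀ {W W′ D} → IsComponent G W′ D → D ⊆ W → W ⊆ W′ → IsComponent G W D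
  isComponent-shrink {W} {W′} {D} D-comp D⊆W W⊆W′ = proj₁ D-comp , λ x y x∈D →
    mk⇔ (stay x∈D ∘ isComponent-connected D-comp x∈D)
        (isComponent-closed D-comp x∈D ∘ Reach-mono W⊆W′)
    where
    stay : ∀ {x y} → x ∈ D → Reach G W′ x y → Reach G W x y
    stay x∈D (here _) = here (D⊆W x∈D)
    stay x∈D (step r z~y y∈W′) = step (stay x∈D r) z~y (D⊆W (isComponent-closed D-comp x∈D (step r z~y y∈W′)))

  sumOver-closed-induction : (P : ℕ → Set) → P 0 → (∀ a b → P a → P b → P (a + b)) →
    ∀ {W} f V → V ⊆ W → (∀ {x y} → x ∈ V → y ∈ W → Adj G x y → y ∈ V) →
    (∀ {x} → x ∈ V → P (sumOver G (component W x) f)) → P (sumOver G V f)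
  sumOver-closed-induction P P0 P+ {W} f V = go V (<-wellFounded ∣ V ∣)
    where
    go : ∀ V → Acc _<_ ∣ V ∣ → V ⊆ W → (∀ {x y} → x ∈ V → y ∈ W → Adj G x y → y ∈ V) →
      (∀ {x} → x ∈ V → P (sumOver G (component W x) f)) → P (sumOver G V f)
    go V (acc smaller) V⊆W V-closed P-components with nonempty? V
    ... | no V-empty = subst P (≡.sym (sumOver-zero V (λ x∈V → ⊥-elim (V-empty (_ , x∈V))))) P0
    ... | yes (x , x∈V) = subst P (≡.sym (sumOver-─ f C⊆V)) (P+ _ _ (P-components x∈V)
          (go (V ─ C) (smaller ∣V─C∣<∣V∣) (V⊆W ∘ p─q⊆p V C) V─C-closed (P-components ∘ p─q⊆p V C)))
      where
      C = component W x
      C-comp = component-isComponent (V⊆W x∈V)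
      x∈C = Equivalence.from ∈component⇔Reach (here (V⊆W x∈V))
      Reach-within : ∀ {y} → Reach G W x y → y ∈ V
      Reach-within (here _) = x∈V
      Reach-within (step r z~y y∈W) = V-closed (Reach-within r) y∈W z~y
      C⊆V : C ⊆ V
      C⊆V = Reach-within ∘ Equivalence.to ∈component⇔Reach
      ∣V─C∣<∣V∣ : ∣ V ─ C ∣ < ∣ V ∣
      ∣V─C∣<∣V∣ = p∩q≢∅⇒∣p─q∣<∣p∣ V C (x , x∈p∩q⁺ (x∈V , x∈C))
      V─C-closed : ∀ {y z} → y ∈ V ─ C → z ∈ W → Adj G y z → z ∈ V ─ C
      V─C-closed {y} y∈V─C z∈W y~z = x∈p∧x∉q⇒x∈p─q (V-closed (p─q⊆p V C y∈V─C) z∈W y~z)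
        (λ z∈C → x∈p─q⇒x∉q y∈V─C (isComponent-adj C-comp z∈C (V⊆W (p─q⊆p V C y∈V─C)) (adj-sym y~z)))

  -- Counting edges

  ∈N⇔Adj : ∀ {u v} → v ∈ N G u ⇔ Adj G u v
  ∈N⇔Adj = ∈-tabulate⇔

  𝟙N-sym : ∀ u v → 𝟙[ N G u ] v ≡ 𝟙[ N G v ] u
  𝟙N-sym u v rewrite Vec.lookup∘tabulate (adj G u) v | Vec.lookup∘tabulate (adj G v) u | Graph.sym G u v = refl

  e₁≡sumOver : ∀ u B → e₁ G u B ≡ sumOver G B 𝟙[ N G u ]
  e₁≡sumOver u B = ∣∩∣≡sumOver𝟙 (N G u) B

  e-comm : ∀ A B → e G A B ≡ e G B A
  e-comm A B = begin
    sumOver G A (λ a → e₁ G a B)                     ≡⟨ sumOver-cong A (λ {a} _ → e₁≡sumOver a B) ⟩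
    sumOver G A (λ a → sumOver G B 𝟙[ N G a ])       ≡⟨ sumOver-comm A B (λ a → 𝟙[ N G a ]) ⟩
    sumOver G B (λ b → sumOver G A λ a → 𝟙[ N G a ] b) ≡⟨ sumOver-cong B (λ {b} _ → sumOver-cong A (λ {a} _ → 𝟙N-sym a b)) ⟩
    sumOver G B (λ b → sumOver G A 𝟙[ N G b ])       ≡⟨ sumOver-cong B (λ {b} _ → e₁≡sumOver b A) ⟨
    sumOver G B (λ b → e₁ G b A)                     ∎
    where open ≡-Reasoning

  parity-e-self : ∀ A → parity (e G A A) ≡ 0ℙ
  parity-e-self A = begin
    parity (e G A A)                                     ≡⟨ cong parity (sumOver-cong A (λ {a} _ → e₁≡sumOver a A)) ⟩
    parity (sumOver G A (λ a → sumOver G A 𝟙[ N G a ]))  ≡⟨ cong parity (sumOver²≡∑∑ A A (λ a → 𝟙[ N G a ])) ⟩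
    parity (∑ λ a → ∑ λ b → M a b)                       ≡⟨ ∑∑-parity-symmetric M M-sym M-diag ⟩
    0ℙ                                                   ∎
    where
    open ≡-Reasoning
    M : Fin n → Fin n → ℕ
    M a b = (A ⇂ λ a → (A ⇂ 𝟙[ N G a ]) b) a
    M-sym : ∀ a b → M a b ≡ M b a
    M-sym a b with lookup A a | lookup A b
    ... | true | true = 𝟙N-sym a b
    ... | true | false = refl
    ... | false | true = refl
    ... | false | false = refl
    M-diag : ∀ a → M a a ≡ 0
    M-diag a with lookup A a
    ... | true rewrite Vec.lookup∘tabulate (adj G a) a | Graph.irrefl G a = refl
    ... | false = refl

  e₁-mono : ∀ u {B B′} → B ⊆ B′ → e₁ G u B ≤ e₁ G u B′
  e₁-mono u B⊆B′ = p⊆q⇒∣p∣≤∣q∣ λ {x} x∈N∩B →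
    let x∈N , x∈B = x∈p∩q⁻ (N G u) _ x∈N∩B in x∈p∩q⁺ (x∈N , B⊆B′ x∈B)

  e₁-positive : ∀ {u B w} → w ∈ B → Adj G u w → 1 ≤ e₁ G u B
  e₁-positive {u} {B} {w} w∈B u~w = subst (_≤ e₁ G u B) (∣⁅x⁆∣≡1 w) (p⊆q⇒∣p∣≤∣q∣ ⁅w⁆⊆N∩B)
    where
    ⁅w⁆⊆N∩B : ⁅ w ⁆ ⊆ N G u ∩ B
    ⁅w⁆⊆N∩B x∈⁅w⁆ rewrite x∈⁅y⁆⇒x≡y w x∈⁅w⁆ = x∈p∩q⁺ (Equivalence.from ∈N⇔Adj u~w , w∈B)

  e₁-nonzero : ∀ u B → ¬ e₁ G u B ≡ 0 → ∃ λ w → w ∈ B × Adj G u w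
  e₁-nonzero u B e₁≢0 with sumOver-nonzero B 𝟙[ N G u ] (e₁≢0 ∘ trans (e₁≡sumOver u B))
  ... | w , w∈B , 𝟙≢0 with w ∈? N G u
  ...   | yes w∈N = w , w∈B , Equivalence.to ∈N⇔Adj w∈N
  ...   | no w∉N = ⊥-elim (𝟙≢0 (⇂-∉ (λ _ → 1) w∉N))

  ∈Rest⁺ : ∀ {S T x} → x ∉ S → x ∉ T → x ∈ Rest G S T
  ∈Rest⁺ x∉S x∉T = x∉p⇒x∈∁p ([ x∉S , x∉T ] ∘ x∈p∪q⁻ _ _)

  ∈Rest⁻ : ∀ {S T x} → x ∈ Rest G S T → x ∉ S × x ∉ T
  ∈Rest⁻ x∈R = (x∈∁p⇒x∉p x∈R ∘ x∈p∪q⁺ ∘ inj₁) , (x∈∁p⇒x∉p x∈R ∘ x∈p∪q⁺ ∘ inj₂)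

  EnumTOdd-length : ∀ {S T Os Os′} → EnumTOdd G S T Os → EnumTOdd G S T Os′ → length Os ≡ length Os′
  EnumTOdd-length (unique , odd , complete) (unique′ , odd′ , complete′) =
    ↭-length (∼bag⇒↭ (unique∧set⇒bag unique unique′ (mk⇔ (λ C∈ → complete′ _ (All.lookup odd C∈))
                                                         (λ C∈ → complete _ (All.lookup odd′ C∈)))))

  awayFrom : Fin n → List (Subset n) → List (Subset n)
  awayFrom v = filter (λ C → e₁ G v C ≟ 0)

-- Barriers

module Barrier {n : ℕ} (G : Graph n) (X S T : Subset n) (S∩T≡∅ : Disjoint G S T) where

  R : Subset n
  R = Rest G S T

  degMinus-split : ∀ v → degMinus G S v ≡ e₁ G v T + e₁ G v R
  degMinus-split v = begin
    degMinus G S v                                   ≡⟨ e₁≡sumOver G v (∁ S) ⟩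
    sumOver G (∁ S) 𝟙[ N G v ]                       ≡⟨ sumOver-⊎ G 𝟙[ N G v ] split T⊆∁S R⊆∁S T∩R≡∅ ⟩
    sumOver G T 𝟙[ N G v ] + sumOver G R 𝟙[ N G v ]  ≡⟨ cong₂ _+_ (e₁≡sumOver G v T) (e₁≡sumOver G v R) ⟨
    e₁ G v T + e₁ G v R                              ∎
    where
    open ≡-Reasoning
    split : ∀ {x} → x ∈ ∁ S → x ∈ T ⊎ x ∈ R
    split {x} x∈∁S with x ∈? T
    ... | yes x∈T = inj₁ x∈T
    ... | no x∉T = inj₂ (∈Rest⁺ G (x∈∁p⇒x∉p x∈∁S) x∉T)
    T⊆∁S : T ⊆ ∁ S
    T⊆∁S {x} x∈T = x∉p⇒x∈∁p (λ x∈S → S∩T≡∅ x x∈S x∈T)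
    R⊆∁S : R ⊆ ∁ S
    R⊆∁S = x∉p⇒x∈∁p ∘ proj₁ ∘ ∈Rest⁻ G
    T∩R≡∅ : Disjoint G T R
    T∩R≡∅ x x∈T x∈R = proj₂ (∈Rest⁻ G x∈R) x∈T

  sumOver-degMinus : sumOver G T (degMinus G S) ≡ e G T T + e G T R
  sumOver-degMinus = trans (sumOver-cong G T (λ {v} _ → degMinus-split v)) (sumOver-+ G T _ _)

  module Enumeration {Os} (Os-enum : EnumTOdd G S T Os) where

    Os-unique : Unique Os
    Os-unique = proj₁ Os-enum

    Os-odd : All (IsTOdd G S T) Os
    Os-odd = proj₁ (proj₂ Os-enum)

    Os-complete : ∀ C → IsTOdd G S T C → C ∈ₗ Os
    Os-complete = proj₂ (proj₂ Os-enum)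

    Os-components : All (IsComponent G R) Os
    Os-components = All.map proj₁ Os-odd

    -- U is the union of the T-even components.
    U : Subset n
    U = R ─ ⋃ Os

    sumOver-R : ∀ f → sumOver G R f ≡ sum (map (λ C → sumOver G C f) Os) + sumOver G U f
    sumOver-R f = sumOver-─⋃ G f (All.map (isComponent-⊆ G) Os-components) (components-disjoint G Os-components Os-unique)

    U-closed : ∀ {x y} → x ∈ U → y ∈ R → Adj G x y → y ∈ U
    U-closed {x} x∈U y∈R x~y = x∈p∧x∉q⇒x∈p─q y∈R y∉⋃Os
      where
      y∉⋃Os : _ ∉ ⋃ Os
      y∉⋃Os y∈⋃Os with ∈⋃⁻ Os y∈⋃Os
      ... | C , C∈Os , y∈C = x∈p─q⇒x∉q x∈U
        (∈⋃⁺ C∈Os (isComponent-adj G (All.lookup Os-components C∈Os) y∈C (p─q⊆p R _ x∈U) (adj-sym G x~y)))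

    component-U-even : ∀ {x} → x ∈ U → IsTEven G S T (component G R x)
    component-U-even {x} x∈U = C-comp , λ C-odd →
      x∈p─q⇒x∉q x∈U (∈⋃⁺ (Os-complete _ (C-comp , C-odd)) (Equivalence.from (∈component⇔Reach G) (here x∈R)))
      where
      x∈R = p─q⊆p R _ x∈U
      C-comp = component-isComponent G x∈R

    even-⊆-U : ∀ {C} → IsTEven G S T C → C ⊆ U
    even-⊆-U (C-comp , C-even) {x} x∈C = x∈p∧x∉q⇒x∈p─q (isComponent-⊆ G C-comp x∈C) x∉⋃Os
      where
      x∉⋃Os : x ∉ ⋃ Os
      x∉⋃Os x∈⋃Os with ∈⋃⁻ Os x∈⋃Os
      ... | D , D∈Os , x∈D = C-even (subst (λ D → Odd G (e G T D))
              (isComponent-unique G (All.lookup Os-components D∈Os) C-comp x∈D x∈C) (proj₂ (All.lookup Os-odd D∈Os)))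

    e-T-R : e G T R ≡ sum (map (e G T) Os) + e G T U
    e-T-R = begin
      e G T R                                                 ≡⟨ e-comm G T R ⟩
      e G R T                                                 ≡⟨ sumOver-R (λ w → e₁ G w T) ⟩
      sum (map (λ C → e G C T) Os) + e G U T                  ≡⟨ cong₂ _+_ (cong sum (map-cong (λ C → e-comm G C T) Os)) (e-comm G U T) ⟩
      sum (map (e G T) Os) + e G T U                          ∎
      where open ≡-Reasoning

    parity-e-T-U : parity (e G T U) ≡ 0ℙ
    parity-e-T-U = trans (cong parity (e-comm G T U))
      (sumOver-closed-induction G (λ m → parity m ≡ 0ℙ) refl parity-+ (λ w → e₁ G w T) U (p─q⊆p R _) U-closed
        (λ {x} x∈U → trans (cong parity (e-comm G _ T)) (¬odd⇒parity≡0ℙ (e G T (component G R x)) (proj₂ (component-U-even x∈U)))))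
      where
      parity-+ : ∀ a b → parity a ≡ 0ℙ → parity b ≡ 0ℙ → parity (a + b) ≡ 0ℙ
      parity-+ a b pa pb = trans (ℙ.+-homo-+ a b) (cong₂ ℙ._+_ pa pb)

    parity-δ : parity (2 * ∣ S ∣ + sumOver G T (degMinus G S)) ≡ parity (2 * ∣ T ∩ X ∣ + length Os)
    parity-δ = begin
      parity (2 * ∣ S ∣ + sumOver G T (degMinus G S))       ≡⟨ parity-2*+ ∣ S ∣ _ ⟩
      parity (sumOver G T (degMinus G S))                   ≡⟨ cong parity sumOver-degMinus ⟩
      parity (e G T T + e G T R)                            ≡⟨ ℙ.+-homo-+ (e G T T) _ ⟩
      parity (e G T T) ℙ.+ parity (e G T R)                 ≡⟨ cong₂ ℙ._+_ (parity-e-self G T) (cong parity e-T-R) ⟩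
      parity (sum (map (e G T) Os) + e G T U)               ≡⟨ ℙ.+-homo-+ (sum (map (e G T) Os)) _ ⟩
      parity (sum (map (e G T) Os)) ℙ.+ parity (e G T U)    ≡⟨ cong₂ ℙ._+_ (parity-sum-odd (e G T) Os-parity) parity-e-T-U ⟩
      parity (length Os) ℙ.+ 0ℙ                             ≡⟨ ℙ.+-identityʳ _ ⟩
      parity (length Os)                                    ≡⟨ parity-2*+ ∣ T ∩ X ∣ _ ⟨
      parity (2 * ∣ T ∩ X ∣ + length Os)                    ∎
      where
      open ≡-Reasoning
      Os-parity : All (λ C → parity (e G T C) ≡ 1ℙ) Os
      Os-parity = All.map (λ {C} C-odd → Equivalence.from (parity≡1ℙ⇔odd (e G T C)) (proj₂ C-odd)) Os-odd

    δ<0⇒gap : δ G X S T (length Os) ℤ.< + 0 →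
      2 + (2 * ∣ S ∣ + sumOver G T (degMinus G S)) ≤ 2 * ∣ T ∩ X ∣ + length Os
    δ<0⇒gap δ<0 = parity-gap (+m-+n<0⇒m<n δ<0) parity-δ

    sum-e₁+e₁-U≤degMinus : ∀ v → sum (map (e₁ G v) Os) + e₁ G v U ≤ degMinus G S v
    sum-e₁+e₁-U≤degMinus v = begin
      sum (map (e₁ G v) Os) + e₁ G v U
        ≡⟨ cong₂ _+_ (cong sum (map-cong (λ C → e₁≡sumOver G v C) Os)) (e₁≡sumOver G v U) ⟩
      sum (map (λ C → sumOver G C 𝟙[ N G v ]) Os) + sumOver G U 𝟙[ N G v ]
        ≡⟨ sumOver-R 𝟙[ N G v ] ⟨
      sumOver G R 𝟙[ N G v ]
        ≡⟨ e₁≡sumOver G v R ⟨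
      e₁ G v R
        ≤⟨ m≤n+m _ _ ⟩
      e₁ G v T + e₁ G v R
        ≡⟨ degMinus-split v ⟨
      degMinus G S v
        ∎
      where open ≤-Reasoning

  module Deletion {v} (v∈T : v ∈ T) {Os} (Os-enum : EnumTOdd G S T Os) where
    open Enumeration Os-enum using (Os-unique; Os-odd; Os-complete; Os-components)

    T′ : Subset n
    T′ = T ∖ v

    R′ : Subset n
    R′ = Rest G S T′

    T′⊆T : T′ ⊆ T
    T′⊆T = p─q⊆p T ⁅ v ⁆

    v∉S : v ∉ S
    v∉S v∈S = S∩T≡∅ v v∈S v∈T

    v∉T′ : v ∉ T′
    v∉T′ v∈T′ = x∈p─q⇒x∉q v∈T′ (x∈⁅x⁆ v)

    v∈R′ : v ∈ R′
    v∈R′ = ∈Rest⁺ G v∉S v∉T′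

    R⊆R′ : R ⊆ R′
    R⊆R′ x∈R = let x∉S , x∉T = ∈Rest⁻ G x∈R in ∈Rest⁺ G x∉S (x∉T ∘ T′⊆T)

    R′⊆v∪R : ∀ {x} → x ∈ R′ → x ≡ v ⊎ x ∈ R
    R′⊆v∪R {x} x∈R′ with x ≟ᶠ v
    ... | yes x≡v = inj₁ x≡v
    ... | no x≢v = let x∉S , x∉T′ = ∈Rest⁻ G x∈R′ in inj₂ (∈Rest⁺ G x∉S (λ x∈T → x∉T′ (x∈p∧x≢y⇒x∈p-y x∈T x≢v)))

    ∣S∪T′∣<∣S∪T∣ : ∣ S ∪ T′ ∣ < ∣ S ∪ T ∣
    ∣S∪T′∣<∣S∪T∣ = p⊂q⇒∣p∣<∣q∣ (S∪T′⊆S∪T , v , x∈p∪q⁺ (inj₂ v∈T) , [ v∉S , v∉T′ ] ∘ x∈p∪q⁻ S T′)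
      where
      S∪T′⊆S∪T : S ∪ T′ ⊆ S ∪ T
      S∪T′⊆S∪T = x∈p∪q⁺ ∘ map₂ T′⊆T ∘ x∈p∪q⁻ S T′

    e-T-remove : ∀ C → e G T C ≡ e₁ G v C + e G T′ C
    e-T-remove C = sumOver-remove G (λ u → e₁ G u C) v∈T

    e-T≡e-T′ : ∀ {C} → e₁ G v C ≡ 0 → e G T C ≡ e G T′ C
    e-T≡e-T′ {C} e₁≡0 = trans (e-T-remove C) (cong (_+ e G T′ C) e₁≡0)

    kept : List (Subset n)
    kept = awayFrom G v Os

    ∈kept⁻ : ∀ {C} → C ∈ₗ kept → C ∈ₗ Os × e₁ G v C ≡ 0
    ∈kept⁻ = ∈-filter⁻ (λ C → e₁ G v C ≟ 0) {xs = Os}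

    kept-odd : ∀ {C} → C ∈ₗ kept → IsTOdd G S T′ C
    kept-odd {C} C∈kept = isComponent-grow G C-comp R⊆R′ no-exit , subst (Odd G) (e-T≡e-T′ e₁≡0) C-odd
      where
      C∈Os = proj₁ (∈kept⁻ C∈kept)
      e₁≡0 = proj₂ (∈kept⁻ C∈kept)
      C-comp = proj₁ (All.lookup Os-odd C∈Os)
      C-odd = proj₂ (All.lookup Os-odd C∈Os)
      no-exit : ∀ {x y} → x ∈ C → y ∈ R′ → Adj G x y → y ∈ R
      no-exit x∈C y∈R′ x~y with R′⊆v∪R y∈R′
      ... | inj₂ y∈R = y∈R
      ... | inj₁ refl = ⊥-elim (1+n≰n (subst (1 ≤_) e₁≡0 (e₁-positive G x∈C (adj-sym G x~y))))

    Cᵥ : Subset n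
    Cᵥ = component G R′ v

    Cᵥ-comp : IsComponent G R′ Cᵥ
    Cᵥ-comp = component-isComponent G v∈R′

    v∈Cᵥ : v ∈ Cᵥ
    v∈Cᵥ = Equivalence.from (∈component⇔Reach G) (here v∈R′)

    odd? : ∀ D → Dec (Odd G (e G T′ D))
    odd? D = e G T′ D % 2 ≟ 1

    -- The components in kept are still T′-odd; all others merge with v into Cᵥ.
    Os′ : List (Subset n)
    Os′ = kept ++ filter odd? (Cᵥ ∷ [])

    Os′-enum : EnumTOdd G S T′ Os′
    Os′-enum = unique , All.++⁺ (All.tabulate kept-odd) (All.tabulate Cᵥ-odd) , complete
      where
      Cᵥ-odd : ∀ {D} → D ∈ₗ filter odd? (Cᵥ ∷ []) → IsTOdd G S T′ D
      Cᵥ-odd D∈ with ∈-filter⁻ odd? {xs = Cᵥ ∷ []} D∈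
      ... | here refl , D-odd = Cᵥ-comp , D-odd
      v∉kept : ∀ {D} → D ∈ₗ kept → v ∉ D
      v∉kept D∈kept v∈D = proj₂ (∈Rest⁻ G (isComponent-⊆ G (All.lookup Os-components (proj₁ (∈kept⁻ D∈kept))) v∈D)) v∈T
      unique : Unique Os′
      unique = ++⁺ (filter⁺ _ Os-unique) (filter⁺ odd? ([] ∷ [])) λ where
        (D∈kept , D∈) → case ∈-filter⁻ odd? {xs = Cᵥ ∷ []} D∈ of λ where
          (here refl , _) → v∉kept D∈kept v∈Cᵥ
      complete : ∀ D → IsTOdd G S T′ D → D ∈ₗ Os′
      complete D (D-comp , D-odd) with v ∈? D
      ... | yes v∈D = ∈-++⁺ʳ kept (∈-filter⁺ odd? (here (isComponent-unique G D-comp Cᵥ-comp v∈D v∈Cᵥ)) D-odd)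
      ... | no v∉D = ∈-++⁺ˡ (∈-filter⁺ _ (Os-complete D D-T-odd) e₁≡0)
        where
        D⊆R : D ⊆ R
        D⊆R {x} x∈D with R′⊆v∪R (isComponent-⊆ G D-comp x∈D)
        ... | inj₁ refl = ⊥-elim (v∉D x∈D)
        ... | inj₂ x∈R = x∈R
        e₁≡0 : e₁ G v D ≡ 0
        e₁≡0 with e₁ G v D ≟ 0
        ... | yes e₁≡0 = e₁≡0
        ... | no e₁≢0 with e₁-nonzero G v D e₁≢0
        ...   | w , w∈D , v~w = ⊥-elim (v∉D (isComponent-adj G D-comp w∈D v∈R′ (adj-sym G v~w)))
        D-T-odd : IsTOdd G S T D
        D-T-odd = isComponent-shrink G D-comp D⊆R R⊆R′ , subst (Odd G) (≡.sym (e-T≡e-T′ e₁≡0)) D-odd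

    deletion-barrier : S ⊆ X → 2 + (2 * ∣ S ∣ + sumOver G T (degMinus G S)) ≤ 2 * ∣ T ∩ X ∣ + length Os →
      2 * 𝟙[ X ] v + length Os ≤ length kept + degMinus G S v + 1 → IsBarrier G X S T′
    deletion-barrier S⊆X gap slack =
      S⊆X , (λ x x∈S x∈T′ → S∩T≡∅ x x∈S (T′⊆T x∈T′)) , Os′ , Os′-enum ,
      m<n⇒+m-+n<0 (≤-trans
        (deletion-arithmetic (∣ S ∣) (degMinus G S v) _ (𝟙[ X ] v) (∣ T′ ∩ X ∣) (length Os) (length kept) gap′ slack)
        (+-monoʳ-≤ (2 * ∣ T′ ∩ X ∣) (length-++-≤ˡ kept)))
      where
      ∣T∩X∣-remove : ∣ T ∩ X ∣ ≡ 𝟙[ X ] v + ∣ T′ ∩ X ∣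
      ∣T∩X∣-remove = begin
        ∣ T ∩ X ∣                         ≡⟨ cong ∣_∣ (∩-comm T X) ⟩
        ∣ X ∩ T ∣                         ≡⟨ ∣∩∣≡sumOver𝟙 G X T ⟩
        sumOver G T 𝟙[ X ]                ≡⟨ sumOver-remove G 𝟙[ X ] v∈T ⟩
        𝟙[ X ] v + sumOver G T′ 𝟙[ X ]    ≡⟨ cong (_+_ (𝟙[ X ] v)) (trans (cong ∣_∣ (∩-comm T′ X)) (∣∩∣≡sumOver𝟙 G X T′)) ⟨
        𝟙[ X ] v + ∣ T′ ∩ X ∣             ∎
        where open ≡-Reasoning
      gap′ : 2 + (2 * ∣ S ∣ + (degMinus G S v + sumOver G T′ (degMinus G S))) ≤ 2 * (𝟙[ X ] v + ∣ T′ ∩ X ∣) + length Os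
      gap′ = subst₂ (λ Σ t → 2 + (2 * ∣ S ∣ + Σ) ≤ 2 * t + length Os) (sumOver-remove G (degMinus G S) v∈T) ∣T∩X∣-remove gap

module MinimumBarrier {n : ℕ} (G : Graph n) (X Y S T : Subset n)
  (bipartite : IsBipartition G X Y) (minimum : IsMinBarrier G X S T) where

  S⊆X : S ⊆ X
  S⊆X = proj₁ (proj₁ minimum)

  S∩T≡∅ : Disjoint G S T
  S∩T≡∅ = proj₁ (proj₂ (proj₁ minimum))

  Os₀ : List (Subset n)
  Os₀ = proj₁ (proj₂ (proj₂ (proj₁ minimum)))

  Os₀-enum : EnumTOdd G S T Os₀
  Os₀-enum = proj₁ (proj₂ (proj₂ (proj₂ (proj₁ minimum))))

  δ<0 : δ G X S T (length Os₀) ℤ.< + 0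
  δ<0 = proj₂ (proj₂ (proj₂ (proj₂ (proj₁ minimum))))

  open Barrier G X S T S∩T≡∅
  open Enumeration Os₀-enum

  no-slack : ∀ {v} → v ∈ T → ¬ 2 * 𝟙[ X ] v + length Os₀ ≤ length (awayFrom G v Os₀) + degMinus G S v + 1
  no-slack v∈T slack = <⇒≱ ∣S∪T′∣<∣S∪T∣ (proj₂ minimum S T′ (deletion-barrier S⊆X (δ<0⇒gap δ<0) slack))
    where open Deletion v∈T Os₀-enum

  Os₀-bound : ∀ v → length Os₀ ≤ length (awayFrom G v Os₀) + degMinus G S v
  Os₀-bound v = ≤-trans (length≤length-filter-zero+sum (e₁ G v) Os₀)
    (+-monoʳ-≤ (length (awayFrom G v Os₀)) (≤-trans (m≤m+n _ _) (sum-e₁+e₁-U≤degMinus v)))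

  slack-∉X : ∀ {v} → v ∉ X → 2 * 𝟙[ X ] v + length Os₀ ≤ length (awayFrom G v Os₀) + degMinus G S v + 1
  slack-∉X {v} v∉X = subst (λ b → 2 * b + length Os₀ ≤ length (awayFrom G v Os₀) + degMinus G S v + 1)
    (≡.sym (⇂-∉ (λ _ → 1) v∉X)) (≤-trans (Os₀-bound v) (m≤m+n _ 1))

  slack-∈X : ∀ {v} → v ∈ X → suc (length Os₀) ≤ length (awayFrom G v Os₀) + degMinus G S v →
    2 * 𝟙[ X ] v + length Os₀ ≤ length (awayFrom G v Os₀) + degMinus G S v + 1
  slack-∈X {v} v∈X bound = subst (λ b → 2 * b + length Os₀ ≤ length (awayFrom G v Os₀) + degMinus G S v + 1)
    (≡.sym (⇂-∈ (λ _ → 1) v∈X)) (subst (2 + length Os₀ ≤_) (+-comm 1 _) (s≤s bound))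

  T⊆X : T ⊆ X
  T⊆X {v} v∈T with v ∈? X
  ... | yes v∈X = v∈X
  ... | no v∉X = ⊥-elim (no-slack v∈T (slack-∉X v∉X))

  no-strict-bound : ∀ {v} → v ∈ T → ¬ suc (length Os₀) ≤ length (awayFrom G v Os₀) + degMinus G S v
  no-strict-bound v∈T = no-slack v∈T ∘ slack-∈X (T⊆X v∈T)

  even-component-detached : ∀ C → IsTEven G S T C → e G T C ≡ 0
  even-component-detached C C-even with e G T C ≟ 0
  ... | yes e≡0 = e≡0
  ... | no e≢0 with sumOver-nonzero G T (λ u → e₁ G u C) e≢0
  ...   | u , u∈T , e₁≢0 = ⊥-elim (no-strict-bound u∈T (begin
    suc (length Os₀)                               ≤⟨ s≤s (length≤length-filter-zero+sum (e₁ G u) Os₀) ⟩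
    suc (length (awayFrom G u Os₀) + Σ)            ≡⟨ +-suc _ Σ ⟨
    length (awayFrom G u Os₀) + suc Σ              ≡⟨ cong (_+_ (length (awayFrom G u Os₀))) (+-comm 1 Σ) ⟩
    length (awayFrom G u Os₀) + (Σ + 1)            ≤⟨ +-monoʳ-≤ (length (awayFrom G u Os₀)) (+-monoʳ-≤ Σ 1≤e₁-U) ⟩
    length (awayFrom G u Os₀) + (Σ + e₁ G u U)     ≤⟨ +-monoʳ-≤ (length (awayFrom G u Os₀)) (sum-e₁+e₁-U≤degMinus u) ⟩
    length (awayFrom G u Os₀) + degMinus G S u     ∎))
    where
    open ≤-Reasoning
    Σ = sum (map (e₁ G u) Os₀)
    1≤e₁-U : 1 ≤ e₁ G u U
    1≤e₁-U = ≤-trans (n≢0⇒n>0 e₁≢0) (e₁-mono G u (even-⊆-U C-even))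

  odd-component-e₁≤1 : ∀ C → IsTOdd G S T C → ∀ u → u ∈ T → e₁ G u C ≤ 1
  odd-component-e₁≤1 C C-odd u u∈T with e₁ G u C ≤? 1
  ... | yes e₁≤1 = e₁≤1
  ... | no e₁≰1 = ⊥-elim (no-strict-bound u∈T (≤-trans
          (length<length-filter-zero+sum (e₁ G u) (Os-complete C C-odd) (≰⇒> e₁≰1))
          (+-monoʳ-≤ (length (awayFrom G u Os₀)) (≤-trans (m≤m+n _ _) (sum-e₁+e₁-U≤degMinus u)))))

  e-T-T≡0 : e G T T ≡ 0
  e-T-T≡0 = sumOver-zero G T e₁-T≡0
    where
    e₁-T≡0 : ∀ {a} → a ∈ T → e₁ G a T ≡ 0
    e₁-T≡0 {a} a∈T with e₁ G a T ≟ 0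
    ... | yes e₁≡0 = e₁≡0
    ... | no e₁≢0 with e₁-nonzero G a T e₁≢0
    ...   | b , b∈T , a~b = ⊥-elim (x∈∁p⇒x∉p b∈∁X (T⊆X b∈T))
      where
      b∈∁X : b ∈ ∁ X
      b∈∁X = subst (b ∈_) (proj₁ bipartite) (proj₁ (proj₂ bipartite) a b a~b (T⊆X a∈T))

  sumOver-degMinus≡sum-e : ∀ {Os} → EnumTOdd G S T Os → sumOver G T (degMinus G S) ≡ sum (map (e G T) Os)
  sumOver-degMinus≡sum-e {Os} Os-enum = begin
    sumOver G T (degMinus G S)             ≡⟨ sumOver-degMinus ⟩
    e G T T + e G T R                      ≡⟨ cong₂ _+_ e-T-T≡0 E.e-T-R ⟩
    sum (map (e G T) Os) + e G T E.U       ≡⟨ cong (_+_ (sum (map (e G T) Os))) e-T-U≡0 ⟩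
    sum (map (e G T) Os) + 0               ≡⟨ +-identityʳ _ ⟩
    sum (map (e G T) Os)                   ∎
    where
    open ≡-Reasoning
    module E = Enumeration Os-enum
    e-T-U≡0 : e G T E.U ≡ 0
    e-T-U≡0 = trans (e-comm G T E.U)
      (sumOver-closed-induction G (_≡ 0) refl (λ _ _ → cong₂ _+_) (λ w → e₁ G w T) E.U (p─q⊆p R _) E.U-closed
        (λ {x} x∈U → trans (e-comm G _ T) (even-component-detached _ (E.component-U-even x∈U))))

  ∣T∩X∣≡∣T∣ : ∣ T ∩ X ∣ ≡ ∣ T ∣
  ∣T∩X∣≡∣T∣ = cong ∣_∣ (⊆-antisym (p∩q⊆p T X) (λ x∈T → x∈p∩q⁺ (x∈T , T⊆X x∈T)))

  excess-bound : ∀ Os → EnumTOdd G S T Os →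
    + sum (map (λ O → e G T O ∸ 1) Os) ℤ.< + 2 ℤ.* (+ ∣ T ∣ - + ∣ S ∣)
  excess-bound Os Os-enum = 2s+m<2t⇒+m<2[t-s] ∣ S ∣ ∣ T ∣ Σ′ (+-cancelʳ-< (length Os) _ _ (begin-strict
    2 * ∣ S ∣ + Σ′ + length Os               ≡⟨ +-assoc (2 * ∣ S ∣) Σ′ _ ⟩
    2 * ∣ S ∣ + (Σ′ + length Os)             ≡⟨ cong (_+_ (2 * ∣ S ∣)) (sum-map-∸1 (e G T) Os-e≥1) ⟩
    2 * ∣ S ∣ + sum (map (e G T) Os)         ≡⟨ cong (_+_ (2 * ∣ S ∣)) (sumOver-degMinus≡sum-e Os-enum) ⟨
    2 * ∣ S ∣ + sumOver G T (degMinus G S)   <⟨ +m-+n<0⇒m<n δ<0 ⟩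
    2 * ∣ T ∩ X ∣ + length Os₀               ≡⟨ cong₂ (λ t q → 2 * t + q) ∣T∩X∣≡∣T∣ (EnumTOdd-length G Os₀-enum Os-enum) ⟩
    2 * ∣ T ∣ + length Os                    ∎))
    where
    open ≤-Reasoning
    Σ′ = sum (map (λ O → e G T O ∸ 1) Os)
    Os-e≥1 : All (λ O → 1 ≤ e G T O) Os
    Os-e≥1 = All.map (λ {O} O-odd → odd⇒1≤ (e G T O) (proj₂ O-odd)) (Enumeration.Os-odd Os-enum)

lemma2p3 : ∀ {n} (G : Graph n) (X Y S T : Subset n) →
    IsBipartition G X Y →
    IsMinBarrier G X S T →
    (T ⊆ X)
    × (∀ C → IsTEven G S T C → e G T C ≡ 0)
    × (∀ C → IsTOdd G S T C → ∀ u → u ∈ T → e₁ G u C ≤ 1)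
    × (∀ Os → EnumTOdd G S T Os →
         + sum (map (λ O → e G T O ∸ 1) Os) ℤ.< + 2 ℤ.* (+ ∣ T ∣ - + ∣ S ∣))
lemma2p3 G X Y S T bipartite minimum = T⊆X , even-component-detached , odd-component-e₁≤1 , excess-bound
  where open MinimumBarrier G X Y S T bipartite minimum
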